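{- Let $A$ be a finite alphabet and $n$ a positive integer. For every nonnegative integer $k$, if $n \ge k(k-1)+2$, then there does not exist a pseudocyclic universal partial word $w \neq \diamond^n$ for $A^n$ with diamondicity $d \ge n-k$. In particular, if $n\ge 2$ and $w \ne \diamond^n$ is a pseudocyclic universal partial word for $A^n$ with diamondicity $d$, then $d < n - \sqrt{n - \tfrac{7}{4}} - \tfrac12$.
   Context: A partial word over $A$ is a finite sequence of characters from $A \cup \{\diamond\}$, where $\diamond \notin A$ is a wild-card symbol; a word over $A$ contains no $\diamond$. $A^n$ denotes the set of words of length $n$ over $A$. For $x = x_1\cdots x_n \in A^n$ and a partial word $w = w_1\cdots w_N$, the position $i$ ($0 \le i \le N-n$) covers $x$ if $x_j = w_{i+j}$ for every $1\le j\le n$ with $w_{i+j}\in A$. A universal partial word for $A^n$ is a partial word $w$ such that every word in $A^n$ is covered by exactly one position of $w$. A window is a string of $n$ consecutive characters of $w$. A partial word $w$ is pseudocyclic if its first $n-1$ characters equal its last $n-1$ characters as strings over $A\cup\{\diamond\}$ (possibly overlapping). Every pseudocyclic universal partial word has the same number $d$ of $\diamond$'s in each window; this $d$ is its diamondicity. $\diamond^n$ denotes the partial word consisting of $n$ diamonds. -}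

module Defs where

open import Data.Nat using (ℕ; zero; suc; _+_; _∸_; _≤_)
open import Data.Fin using (Fin; toℕ)
open import Data.Vec using (Vec; lookup)
open import Data.List using (List; []; _∷_; length; take; drop; replicate)
open import Data.Maybe using (Maybe; just; nothing)
open import Data.Product using (Σ; _×_)
open import Relation.Binary.PropositionalEquality using (_≡_)

data Sym (m : ℕ) : Set where
  ⋄  : Sym m
  ch : Fin m → Sym m

PartialWord : ℕ → Set
PartialWord m = List (Sym m)

index : {A : Set} → List A → ℕ → Maybe A
index []       _       = nothing
index (x ∷ xs) zero    = just x
index (x ∷ xs) (suc i) = index xs i

Covers : {m : ℕ} (n : ℕ) → PartialWord m → ℕ → Vec (Fin m) n → Set
Covers {m} n w i x =
  (i + n ≤ length w) ×
  ((j : Fin n) (c : Fin m) → index w (i + toℕ j) ≡ just (ch c) → lookup x j ≡ c)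

Universal : (m n : ℕ) → PartialWord m → Set
Universal m n w =
  (x : Vec (Fin m) n) →
  Σ ℕ (λ i → Covers n w i x × ((i' : ℕ) → Covers n w i' x → i' ≡ i))

Pseudocyclic : {m : ℕ} → ℕ → PartialWord m → Set
Pseudocyclic n w = (n ∸ 1 ≤ length w) × (take (n ∸ 1) w ≡ drop (length w ∸ (n ∸ 1)) w)

countDiamonds : {m : ℕ} → PartialWord m → ℕ
countDiamonds []         = 0
countDiamonds (⋄ ∷ w)    = suc (countDiamonds w)
countDiamonds (ch _ ∷ w) = countDiamonds w

HasDiamondicity : {m : ℕ} → ℕ → PartialWord m → ℕ → Set
HasDiamondicity n w d =
  (i : ℕ) → i + n ≤ length w → countDiamonds (take n (drop i w)) ≡ d

diamonds : {m : ℕ} → ℕ → PartialWord m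
diamonds n = replicate n ⋄

module Submission where

-- Pseudocyclicity makes w periodic with period P = |w| − (n − 1), and comparing consecutive
-- windows shows that its diamond pattern, read modulo P, is invariant under the shift by n.
-- Universality forces any two distinct positions of w to clash on a letter, so (shifting
-- by n where needed) every nonzero residue δ modulo n is a difference s' − s of two letter
-- positions s, s' of the first window.  With n − d letters there are at most
-- (n − d)(n − d − 1) such differences, whence n − 1 ≤ k(k − 1) whenever d ≥ n − k.  The bound
-- on d is this with k = n − d.

open import Defs
open import Data.Nat using (ℕ; _+_; _*_; _∸_; _^_; _≤_; _<_)
open import Data.Empty using (⊥)
open import Data.Product using (_×_)
open import Relation.Binary.PropositionalEquality using (_≢_)
open import Data.Nat
  using (zero; suc; _%_; _⊓_; _<?_; _≟_; z≤n; s≤s; NonZero; >-nonZero)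
open import Data.Nat.Properties
open import Data.Nat.DivMod
open import Data.Nat.Tactic.RingSolver using (solve-∀)
open import Data.Fin as Fin using (Fin; toℕ; combine; punchOut)
open import Data.Fin.Properties
  using (combine-injective; punchOut-injective; toℕ<n; toℕ-injective; any?; injective⇒≤)
open import Data.Vec as Vec using (Vec; tabulate)
open import Data.Vec.Properties using (lookup∘tabulate)
open import Data.List using (List; []; _∷_; length; take; drop; replicate; lookup)
open import Data.List.Properties using (length-take; take-take; take-[])
open import Data.List.Membership.Propositional using (_∈_)
open import Data.List.Relation.Unary.Any using (here; there)
import Data.List.Relation.Unary.Any as Any
open import Data.List.Relation.Unary.Any.Properties using (lookup-index)
open import Data.Maybe using (Maybe; just; nothing)
open import Data.Product using (∃-syntax; _,_; proj₁; proj₂)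
open import Data.Sum using (_⊎_; inj₁; inj₂)
open import Function.Definitions using (Injective)
open import Relation.Nullary using (Dec; yes; no; ¬_; _×-dec_; contradiction)
open import Relation.Binary.PropositionalEquality
  using (_≡_; refl; sym; trans; cong; cong₂; subst; module ≡-Reasoning)

private
  variable
    A : Set
    m : ℕ

index-take : ∀ k (u : List A) j → j < k → index (take k u) j ≡ index u j
index-take (suc k) []      j       _         = refl
index-take (suc k) (x ∷ u) zero    _         = refl
index-take (suc k) (x ∷ u) (suc j) (s≤s j<k) = index-take k u j j<k

index-drop : ∀ k (u : List A) j → index (drop k u) j ≡ index u (k + j)
index-drop zero    u       j = refl
index-drop (suc k) []      j = refl
index-drop (suc k) (x ∷ u) j = index-drop k u j

drop≡take⇒index-shift : ∀ (u : List A) p q → drop p u ≡ take q u →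
                        ∀ j → j < q → index u (p + j) ≡ index u j
drop≡take⇒index-shift u p q eq j j<q = begin
  index u (p + j)     ≡⟨ index-drop p u j ⟨
  index (drop p u) j  ≡⟨ cong (λ v → index v j) eq ⟩
  index (take q u) j  ≡⟨ index-take q u j j<q ⟩
  index u j           ∎
  where open ≡-Reasoning

index-periodic : ∀ (u : List A) p .{{_ : NonZero p}} →
                 (∀ j → p + j < length u → index u (p + j) ≡ index u j) →
                 ∀ i → i < length u → index u i ≡ index u (i % p)
index-periodic u p shift i i<N =
  trans (cong (index u) i≡) (reduce (i / p) (i % p) (subst (_< length u) i≡ i<N))
  where
  i≡ : i ≡ i / p * p + i % p
  i≡ = trans (m≡m%n+[m/n]*n i p) (+-comm (i % p) _)
  reduce : ∀ q r → q * p + r < length u → index u (q * p + r) ≡ index u r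
  reduce zero    r _  = refl
  reduce (suc q) r lt = begin
    index u (p + q * p + r)    ≡⟨ cong (index u) (+-assoc p (q * p) r) ⟩
    index u (p + (q * p + r))  ≡⟨ shift (q * p + r) (subst (_< length u) (+-assoc p _ r) lt) ⟩
    index u (q * p + r)        ≡⟨ reduce q r (≤-<-trans (m≤n+m (q * p + r) p)
                                              (subst (_< length u) (+-assoc p _ r) lt)) ⟩
    index u r                  ∎
    where open ≡-Reasoning

%-absorbˡ : ∀ a b d .{{_ : NonZero d}} → (a % d + b) % d ≡ (a + b) % d
%-absorbˡ a b d = begin
  (a % d + b) % d          ≡⟨ %-distribˡ-+ (a % d) b d ⟩
  (a % d % d + b % d) % d  ≡⟨ cong (λ x → (x + b % d) % d) (m%n%n≡m%n a d) ⟩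
  (a % d + b % d) % d      ≡⟨ %-distribˡ-+ a b d ⟨
  (a + b) % d              ∎
  where open ≡-Reasoning

%-unshift : ∀ {n t δ} .{{_ : NonZero n}} → t ≤ n → δ < n → δ ≡ ((t + δ) % n + (n ∸ t)) % n
%-unshift {n} {t} {δ} t≤n δ<n = begin
  δ                          ≡⟨ m<n⇒m%n≡m δ<n ⟨
  δ % n                      ≡⟨ [m+n]%n≡m%n δ n ⟨
  (δ + n) % n                ≡⟨ cong (_% n) (sym rearrange) ⟩
  (t + δ + (n ∸ t)) % n      ≡⟨ %-absorbˡ (t + δ) (n ∸ t) n ⟨
  ((t + δ) % n + (n ∸ t)) % n ∎
  where
  open ≡-Reasoning
  rearrange : t + δ + (n ∸ t) ≡ δ + n
  rearrange = trans (cong (_+ (n ∸ t)) (+-comm t δ))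
                    (trans (+-assoc δ t (n ∸ t)) (cong (δ +_) (m+[n∸m]≡n t≤n)))

+-%-cancelˡ : ∀ {n t δ₁ δ₂} .{{_ : NonZero n}} → t ≤ n → δ₁ < n → δ₂ < n →
              (t + δ₁) % n ≡ (t + δ₂) % n → δ₁ ≡ δ₂
+-%-cancelˡ {n} {t} t≤n δ₁<n δ₂<n eq =
  trans (%-unshift t≤n δ₁<n)
        (trans (cong (λ r → (r + (n ∸ t)) % n) eq) (sym (%-unshift t≤n δ₂<n)))

square-bound : ∀ s n → n ≤ suc s * s + 1 → 4 * n < (2 * suc s ∸ 1) ^ 2 + 7
square-bound s n n≤ = begin-strict
  4 * n                        ≤⟨ *-monoʳ-≤ 4 n≤ ⟩
  4 * (suc s * s + 1)          <⟨ m<m+n _ (s≤s z≤n) ⟩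
  4 * (suc s * s + 1) + 4      ≡⟨ expand s ⟩
  (1 + 2 * s) ^ 2 + 7          ≡⟨ cong (λ a → a ^ 2 + 7) (cong (_∸ 1) (*-suc 2 s)) ⟨
  (2 * suc s ∸ 1) ^ 2 + 7      ∎
  where
  open ≤-Reasoning
  -- ^ 2 is unfolded: the solver does not read _^_.
  expand : ∀ x → 4 * (suc x * x + 1) + 4 ≡ (1 + 2 * x) * ((1 + 2 * x) * 1) + 7
  expand = solve-∀

offDiagonal-injection⇒≤ : ∀ (xs : List A) {K} (g : Fin K → A × A) →
  (∀ i → proj₁ (g i) ∈ xs) → (∀ i → proj₂ (g i) ∈ xs) → (∀ i → proj₁ (g i) ≢ proj₂ (g i)) →
  Injective _≡_ _≡_ g → K ≤ length xs * (length xs ∸ 1)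
offDiagonal-injection⇒≤ [] {zero}  g ∈₁ ∈₂ distinct inj = z≤n
offDiagonal-injection⇒≤ [] {suc K} g ∈₁ ∈₂ distinct inj with () ← ∈₁ Fin.zero
offDiagonal-injection⇒≤ xs@(_ ∷ _) g ∈₁ ∈₂ distinct inj = injective⇒≤ code-injective
  where
  pos₁ pos₂ : ∀ i → Fin (length xs)
  pos₁ i = Any.index (∈₁ i)
  pos₂ i = Any.index (∈₂ i)
  pos-injective : ∀ {a b} (p : a ∈ xs) (q : b ∈ xs) → Any.index p ≡ Any.index q → a ≡ b
  pos-injective p q e = trans (lookup-index p) (trans (cong (lookup xs) e) (sym (lookup-index q)))
  pos₁≢pos₂ : ∀ i → pos₁ i ≢ pos₂ i
  pos₁≢pos₂ i e = distinct i (pos-injective (∈₁ i) (∈₂ i) e)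
  code : ∀ i → Fin (length xs * (length xs ∸ 1))
  code i = combine (pos₁ i) (punchOut (pos₁≢pos₂ i))
  code-injective : Injective _≡_ _≡_ code
  code-injective {i} {j} e with combine-injective (pos₁ i) _ (pos₁ j) _ e
  ... | e₁ , e₂ = inj (cong₂ _,_ (pos-injective (∈₁ i) (∈₁ j) e₁)
                                 (pos-injective (∈₂ i) (∈₂ j) (second e₁ e₂)))
    where
    second : pos₁ i ≡ pos₁ j → punchOut (pos₁≢pos₂ i) ≡ punchOut (pos₁≢pos₂ j) → pos₂ i ≡ pos₂ j
    second e₁ e₂ with pos₁ i | pos₁≢pos₂ i | e₁
    ... | _ | ≢ᵢ | refl = punchOut-injective ≢ᵢ (pos₁≢pos₂ j) e₂

IsLetter : Maybe (Sym m) → Set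
IsLetter {m} s = ∃[ c ] s ≡ just (ch {m} c)

isLetter? : (s : Maybe (Sym m)) → Dec (IsLetter s)
isLetter? nothing       = no λ ()
isLetter? (just ⋄)      = no λ ()
isLetter? (just (ch c)) = yes (c , refl)

Letter : PartialWord m → ℕ → Set
Letter u i = IsLetter (index u i)

isDiamond : Maybe (Sym m) → ℕ
isDiamond (just ⋄) = 1
isDiamond _        = 0

diamondAt : PartialWord m → ℕ → ℕ
diamondAt u i = isDiamond (index u i)

countDiamonds-∷ : (x : Sym m) (v : PartialWord m) →
                  countDiamonds (x ∷ v) ≡ isDiamond (just x) + countDiamonds v
countDiamonds-∷ ⋄      v = refl
countDiamonds-∷ (ch _) v = refl

countDiamonds-take-suc : ∀ k (u : PartialWord m) →
  countDiamonds (take (suc k) u) ≡ countDiamonds (take k u) + diamondAt u k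
countDiamonds-take-suc zero    []         = refl
countDiamonds-take-suc (suc k) []         = refl
countDiamonds-take-suc zero    (⋄ ∷ u)    = refl
countDiamonds-take-suc zero    (ch _ ∷ u) = refl
countDiamonds-take-suc (suc k) (x ∷ u) = begin
  countDiamonds (x ∷ take (suc k) u)                             ≡⟨ countDiamonds-∷ x _ ⟩
  isDiamond (just x) + countDiamonds (take (suc k) u)            ≡⟨ cong (isDiamond (just x) +_) (countDiamonds-take-suc k u) ⟩
  isDiamond (just x) + (countDiamonds (take k u) + diamondAt u k) ≡⟨ +-assoc (isDiamond (just x)) _ _ ⟨
  isDiamond (just x) + countDiamonds (take k u) + diamondAt u k  ≡⟨ cong (_+ diamondAt u k) (countDiamonds-∷ x (take k u)) ⟨
  countDiamonds (x ∷ take k u) + diamondAt u k                   ∎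
  where open ≡-Reasoning

countDiamonds-take-suc-drop : ∀ k i (u : PartialWord m) →
  countDiamonds (take (suc k) (drop i u)) ≡ diamondAt u i + countDiamonds (take k (drop (suc i) u))
countDiamonds-take-suc-drop k zero    []      = cong countDiamonds (sym (take-[] k))
countDiamonds-take-suc-drop k (suc i) []      = cong countDiamonds (sym (take-[] k))
countDiamonds-take-suc-drop k zero    (x ∷ u) = countDiamonds-∷ x (take k u)
countDiamonds-take-suc-drop k (suc i) (x ∷ u) = countDiamonds-take-suc-drop k i u

diamondAt-shift : ∀ (u : PartialWord m) k i j →
  take k (drop (suc i) u) ≡ take k (drop j u) →
  countDiamonds (take (suc k) (drop i u)) ≡ countDiamonds (take (suc k) (drop j u)) →
  diamondAt u i ≡ diamondAt u (j + k)
diamondAt-shift u k i j shared same = +-cancelʳ-≡ X _ _ (begin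
  diamondAt u i + X                                  ≡⟨ cong (λ v → diamondAt u i + countDiamonds v) shared ⟨
  diamondAt u i + countDiamonds (take k (drop (suc i) u)) ≡⟨ countDiamonds-take-suc-drop k i u ⟨
  countDiamonds (take (suc k) (drop i u))            ≡⟨ same ⟩
  countDiamonds (take (suc k) (drop j u))            ≡⟨ countDiamonds-take-suc k (drop j u) ⟩
  X + diamondAt (drop j u) k                         ≡⟨ cong (λ s → X + isDiamond s) (index-drop j u k) ⟩
  X + diamondAt u (j + k)                            ≡⟨ +-comm X _ ⟩
  diamondAt u (j + k) + X                            ∎)
  where
  open ≡-Reasoning
  X = countDiamonds (take k (drop j u))

index-defined : ∀ (u : List A) {j} → j < length u → index u j ≢ nothing
index-defined (x ∷ u) {zero}  _         ()
index-defined (x ∷ u) {suc j} (s≤s j<N) = index-defined u j<N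

isDiamond-letter : ∀ {s t : Maybe (Sym m)} → isDiamond s ≡ isDiamond t → t ≢ nothing →
                   IsLetter s → IsLetter t
isDiamond-letter {t = nothing}     _  t≢nothing _       = contradiction refl t≢nothing
isDiamond-letter {t = just ⋄}      () _         (_ , refl)
isDiamond-letter {t = just (ch c)} _  _         _       = c , refl

diamondAt-letter : ∀ (u : PartialWord m) {i j} → diamondAt u i ≡ diamondAt u j → j < length u →
                   Letter u i → Letter u j
diamondAt-letter u same j<N = isDiamond-letter same (index-defined u j<N)

firstLetter : Fin m → Maybe (Sym m) → Maybe (Sym m) → Fin m
firstLetter _ (just (ch c)) _             = c
firstLetter _ _             (just (ch c)) = c
firstLetter z _             _             = z

firstLetter-second : ∀ (z : Fin m) {s} c → ¬ IsLetter s → firstLetter z s (just (ch c)) ≡ c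
firstLetter-second z {nothing}     c _         = refl
firstLetter-second z {just ⋄}      c _         = refl
firstLetter-second z {just (ch a)} c ¬letter = contradiction (a , refl) ¬letter

-- If no offset t has letters at both i + t and j + t, the word reading the letters of either
-- window (and anything elsewhere) is covered at i and at j.
universal⇒clash : ∀ {n} {w : PartialWord (suc m)} → Universal (suc m) n w →
  ∀ {i j} → i + n ≤ length w → j + n ≤ length w → i ≢ j →
  ∃[ t ] t < n × Letter w (i + t) × Letter w (j + t)
universal⇒clash {m} {n} {w} univ {i} {j} i-fits j-fits i≢j
  with any? (λ t → isLetter? (index w (i + toℕ t)) ×-dec isLetter? (index w (j + toℕ t)))
... | yes (t , clash) = toℕ t , toℕ<n t , clash
... | no no-clash = contradiction (trans (unique i covered-at-i) (sym (unique j covered-at-j))) i≢j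
  where
  letters : Fin n → Fin (suc m)
  letters t = firstLetter Fin.zero (index w (i + toℕ t)) (index w (j + toℕ t))
  x : Vec (Fin (suc m)) n
  x = tabulate letters
  unique : ∀ k → Covers n w k x → k ≡ proj₁ (univ x)
  unique = proj₂ (proj₂ (univ x))
  covered-at-i : Covers n w i x
  covered-at-i = i-fits , λ t c eᵢ →
    trans (lookup∘tabulate letters t) (cong (λ s → firstLetter Fin.zero s (index w (j + toℕ t))) eᵢ)
  covered-at-j : Covers n w j x
  covered-at-j = j-fits , λ t c eⱼ → begin
    Vec.lookup x t                                        ≡⟨ lookup∘tabulate letters t ⟩
    firstLetter Fin.zero (index w (i + toℕ t)) (index w (j + toℕ t)) ≡⟨ cong (firstLetter Fin.zero (index w (i + toℕ t))) eⱼ ⟩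
    firstLetter Fin.zero (index w (i + toℕ t)) (just (ch c))         ≡⟨ firstLetter-second Fin.zero c
                                                                          (λ lᵢ → no-clash (t , lᵢ , c , eⱼ)) ⟩
    c                                                     ∎
    where open ≡-Reasoning

letter-take⁺ : ∀ {n} {u : PartialWord m} {a} → a < n → Letter u a → Letter (take n u) a
letter-take⁺ {n = n} {u} {a} a<n = subst IsLetter (sym (index-take n u a a<n))

replicate⋄-or-letter : (u : PartialWord m) → u ≡ replicate (length u) ⋄ ⊎ ∃[ t ] t < length u × Letter u t
replicate⋄-or-letter []         = inj₁ refl
replicate⋄-or-letter (ch c ∷ u) = inj₂ (0 , s≤s z≤n , c , refl)
replicate⋄-or-letter (⋄ ∷ u) with replicate⋄-or-letter u
... | inj₁ e              = inj₁ (cong (⋄ ∷_) e)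
... | inj₂ (t , t<N , l)  = inj₂ (suc t , s≤s t<N , l)

letterPositionsFrom : ℕ → PartialWord m → List ℕ
letterPositionsFrom k []         = []
letterPositionsFrom k (⋄ ∷ u)    = letterPositionsFrom (suc k) u
letterPositionsFrom k (ch _ ∷ u) = k ∷ letterPositionsFrom (suc k) u

length-letterPositionsFrom : ∀ k (u : PartialWord m) →
  length (letterPositionsFrom k u) + countDiamonds u ≡ length u
length-letterPositionsFrom k []         = refl
length-letterPositionsFrom k (⋄ ∷ u)    =
  trans (+-suc _ _) (cong suc (length-letterPositionsFrom (suc k) u))
length-letterPositionsFrom k (ch _ ∷ u) = cong suc (length-letterPositionsFrom (suc k) u)

∈-letterPositionsFrom⁺ : ∀ k (u : PartialWord m) {a} → Letter u a → k + a ∈ letterPositionsFrom k u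
∈-letterPositionsFrom⁺ k (ch _ ∷ u) {zero}  _ = here (+-identityʳ k)
∈-letterPositionsFrom⁺ k (⋄ ∷ u)    {suc a} l =
  subst (_∈ letterPositionsFrom (suc k) u) (sym (+-suc k a)) (∈-letterPositionsFrom⁺ (suc k) u l)
∈-letterPositionsFrom⁺ k (ch _ ∷ u) {suc a} l =
  there (subst (_∈ letterPositionsFrom (suc k) u) (sym (+-suc k a)) (∈-letterPositionsFrom⁺ (suc k) u l))

module PseudocyclicUniversal {m n' : ℕ} {w : PartialWord (suc m)} {d : ℕ}
  (pseudocyclic : Pseudocyclic (suc n') w) (univ : Universal (suc m) (suc n') w)
  (diamondicity : HasDiamondicity (suc n') w d) where

  n N P : ℕ
  n = suc n'
  N = length w
  P = N ∸ n'

  n≤N : n ≤ N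
  n≤N with univ (Vec.replicate n Fin.zero)
  ... | i , (fits , _) , _ = m+n≤o⇒n≤o i fits

  P+n'≡N : P + n' ≡ N
  P+n'≡N = m∸n+n≡m (<⇒≤ n≤N)

  instance
    P-nonZero : NonZero P
    P-nonZero = >-nonZero (m<n⇒0<n∸m n≤N)

  window-fits : ∀ {a} → a < P → a + n ≤ N
  window-fits {a} a<P = begin
    a + suc n'  ≡⟨ +-suc a n' ⟩
    suc a + n'  ≤⟨ +-monoˡ-≤ n' a<P ⟩
    P + n'      ≡⟨ P+n'≡N ⟩
    N           ∎
    where open ≤-Reasoning

  drop-period : drop P w ≡ take n' w
  drop-period = sym (proj₂ pseudocyclic)

  periodic : ∀ i → i < N → index w i ≡ index w (i % P)
  periodic = index-periodic w P λ j P+j<N →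
    drop≡take⇒index-shift w P n' drop-period j (+-cancelˡ-< P j n' (subst (P + j <_) (sym P+n'≡N) P+j<N))

  -- Compare the window at y with the next one, or, when y is the last window, with the first.
  diamondAt-+n : ∀ {y} → y < P → diamondAt w y ≡ diamondAt w ((y + n) % P)
  diamondAt-+n {y} y<P with suc y <? P
  ... | yes 1+y<P = begin
    diamondAt w y              ≡⟨ diamondAt-shift w n' y (suc y) refl
                                    (trans (diamondicity y (window-fits y<P)) (sym (diamondicity (suc y) (window-fits 1+y<P)))) ⟩
    diamondAt w (suc y + n')   ≡⟨ cong (diamondAt w) (+-suc y n') ⟨
    diamondAt w (y + n)        ≡⟨ cong isDiamond (periodic (y + n) (window-fits 1+y<P)) ⟩
    diamondAt w ((y + n) % P)  ∎
    where open ≡-Reasoning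
  ... | no 1+y≮P = begin
    diamondAt w y              ≡⟨ diamondAt-shift w n' y 0 wrap
                                    (trans (diamondicity y (window-fits y<P)) (sym (diamondicity 0 n≤N))) ⟩
    diamondAt w n'             ≡⟨ cong isDiamond (periodic n' n≤N) ⟩
    diamondAt w (n' % P)       ≡⟨ cong (diamondAt w) wrap% ⟨
    diamondAt w ((y + n) % P)  ∎
    where
    open ≡-Reasoning
    1+y≡P : suc y ≡ P
    1+y≡P = ≤-antisym y<P (≮⇒≥ 1+y≮P)
    wrap : take n' (drop (suc y) w) ≡ take n' w
    wrap = begin
      take n' (drop (suc y) w)  ≡⟨ cong (λ k → take n' (drop k w)) 1+y≡P ⟩
      take n' (drop P w)        ≡⟨ cong (take n') drop-period ⟩
      take n' (take n' w)       ≡⟨ take-take n' n' w ⟩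
      take (n' ⊓ n') w          ≡⟨ cong (λ k → take k w) (⊓-idem n') ⟩
      take n' w                 ∎
    wrap% : (y + n) % P ≡ n' % P
    wrap% = begin
      (y + n) % P       ≡⟨ cong (_% P) (trans (+-suc y n') (cong (_+ n') 1+y≡P)) ⟩
      (P + n') % P      ≡⟨ cong (_% P) (+-comm P n') ⟩
      (n' + P) % P      ≡⟨ [m+n]%n≡m%n n' P ⟩
      n' % P            ∎

  LetterMod : ℕ → Set
  LetterMod x = Letter w (x % P)

  letter⇒letterMod : ∀ {i} → i < N → Letter w i → LetterMod i
  letter⇒letterMod {i} i<N = subst IsLetter (periodic i i<N)

  letterMod⇒letter : ∀ {i} → i < N → LetterMod i → Letter w i
  letterMod⇒letter {i} i<N = subst IsLetter (sym (periodic i i<N))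

  letterMod-unshift : ∀ x → LetterMod (x + n) → LetterMod x
  letterMod-unshift x l = diamondAt-letter w (sym (diamondAt-+n y<P)) (<-≤-trans y<P (m∸n≤m N n'))
                            (subst (Letter w) (sym (%-absorbˡ x n P)) l)
    where
    y<P : x % P < P
    y<P = m%n<n x P

  shift-letterMod : ∀ {a t} → Letter w (a % P + t) → a % P + t < N → LetterMod (t + a)
  shift-letterMod {a} {t} l a%P+t<N =
    subst (Letter w) (trans (%-absorbˡ a t P) (cong (_% P) (+-comm a t))) (letter⇒letterMod a%P+t<N l)

  -- A letter of the first window at t₀ handles the shifts δ ≡ 0 (mod P); otherwise positions
  -- 0 and δ % P clash on a letter.
  letter-difference : ∀ {t₀} → t₀ < n → Letter w t₀ → ∀ δ → ∃[ t ] t < n × Letter w t × LetterMod (t + δ)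
  letter-difference {t₀} t₀<n l₀ δ with δ % P ≟ 0
  ... | yes δ%P≡0 = t₀ , t₀<n , l₀ ,
    shift-letterMod (subst (λ r → Letter w (r + t₀)) (sym δ%P≡0) l₀)
                    (subst (λ r → r + t₀ < N) (sym δ%P≡0) (<-≤-trans t₀<n n≤N))
  ... | no δ%P≢0 with universal⇒clash {w = w} univ {0} {δ % P} n≤N (window-fits (m%n<n δ P))
                                      (λ 0≡δ%P → δ%P≢0 (sym 0≡δ%P))
  ...   | t , t<n , lₜ , l = t , t<n , lₜ ,
    shift-letterMod l (<-≤-trans (+-monoʳ-< (δ % P) t<n) (window-fits (m%n<n δ P)))

  letterMod⇒letter-%n : ∀ {x} → x < n + n → LetterMod x → Letter w (x % n)
  letterMod⇒letter-%n {x} x<2n l with x <? n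
  ... | yes x<n = subst (Letter w) (sym (m<n⇒m%n≡m x<n)) (letterMod⇒letter (<-≤-trans x<n n≤N) l)
  ... | no x≮n = subst (Letter w) (sym x%n≡x∸n)
                   (letterMod⇒letter (<-≤-trans x∸n<n n≤N)
                     (letterMod-unshift (x ∸ n) (subst LetterMod (sym (m∸n+n≡m (≮⇒≥ x≮n))) l)))
    where
    x∸n<n : x ∸ n < n
    x∸n<n = m<n+o⇒m∸n<o x n x<2n
    x%n≡x∸n : x % n ≡ x ∸ n
    x%n≡x∸n = trans (sym (m≤n⇒[n∸m]%m≡n%m (≮⇒≥ x≮n))) (m<n⇒m%n≡m x∸n<n)

  N≡n : ¬ n < N → N ≡ n
  N≡n n≮N = ≤-antisym (≮⇒≥ n≮N) n≤N

  firstWindow-letter : w ≢ diamonds n → ∃[ t ] t < n × Letter w t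
  firstWindow-letter w≢⋄ⁿ with n <? N
  ... | yes n<N with universal⇒clash {w = w} univ {0} {1} n≤N n<N (λ ())
  ...   | t , t<n , l , _ = t , t<n , l
  firstWindow-letter w≢⋄ⁿ | no n≮N with replicate⋄-or-letter w
  ...   | inj₁ w≡⋄ᴺ          = contradiction (trans w≡⋄ᴺ (cong (λ k → replicate k ⋄) (N≡n n≮N))) w≢⋄ⁿ
  ...   | inj₂ (t , t<N , l) = t , subst (t <_) (N≡n n≮N) t<N , l

  S : List ℕ
  S = letterPositionsFrom 0 (take n w)

  ∈S : ∀ {t} → t < n → Letter w t → t ∈ S
  ∈S t<n l = ∈-letterPositionsFrom⁺ 0 (take n w) (letter-take⁺ {u = w} t<n l)

  |S|+d≡n : length S + d ≡ n
  |S|+d≡n = begin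
    length S + d                        ≡⟨ cong (length S +_) (diamondicity 0 n≤N) ⟨
    length S + countDiamonds (take n w) ≡⟨ length-letterPositionsFrom 0 (take n w) ⟩
    length (take n w)                   ≡⟨ length-take n w ⟩
    n ⊓ N                               ≡⟨ m≤n⇒m⊓n≡m n≤N ⟩
    n                                   ∎
    where open ≡-Reasoning

  -- Each nonzero residue δ modulo n is realised as (t, (t + δ) % n) with both ends in S.
  differences-bound : w ≢ diamonds n → n' ≤ length S * (length S ∸ 1)
  differences-bound w≢⋄ⁿ with firstWindow-letter w≢⋄ⁿ
  ... | t₀ , t₀<n , l₀ = offDiagonal-injection⇒≤ S pair
          (λ i → ∈S (t<n i) (letterₜ i)) (λ i → ∈S (m%n<n (t i + δ i) n) (letterₜ₊δ i)) distinct injective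
    where
    δ : Fin n' → ℕ
    δ i = suc (toℕ i)
    δ<n : ∀ i → δ i < n
    δ<n i = s≤s (toℕ<n i)
    witness : ∀ i → ∃[ t ] t < n × Letter w t × LetterMod (t + δ i)
    witness i = letter-difference t₀<n l₀ (δ i)
    t : Fin n' → ℕ
    t i = proj₁ (witness i)
    t<n : ∀ i → t i < n
    t<n i = proj₁ (proj₂ (witness i))
    letterₜ : ∀ i → Letter w (t i)
    letterₜ i = proj₁ (proj₂ (proj₂ (witness i)))
    letterₜ₊δ : ∀ i → Letter w ((t i + δ i) % n)
    letterₜ₊δ i = letterMod⇒letter-%n (+-mono-< (t<n i) (δ<n i)) (proj₂ (proj₂ (proj₂ (witness i))))
    pair : Fin n' → ℕ × ℕ
    pair i = t i , (t i + δ i) % n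
    distinct : ∀ i → t i ≢ (t i + δ i) % n
    distinct i tᵢ≡ = 0≢1+n (+-%-cancelˡ (<⇒≤ (t<n i)) (s≤s z≤n) (δ<n i)
      (trans (cong (_% n) (+-identityʳ (t i))) (trans (m<n⇒m%n≡m (t<n i)) tᵢ≡)))
    injective : Injective _≡_ _≡_ pair
    injective {i} {j} eq = toℕ-injective (suc-injective (+-%-cancelˡ (<⇒≤ (t<n i)) (δ<n i) (δ<n j)
      (trans (cong proj₂ eq) (cong (λ r → (r + δ j) % n) (sym (cong proj₁ eq))))))

  no-diamondicity-above : ∀ k → k * (k ∸ 1) + 2 ≤ n → w ≢ diamonds n → n ∸ k ≤ d → ⊥
  no-diamondicity-above k k[k-1]+2≤n w≢⋄ⁿ n∸k≤d =
    1+n≰n (subst (_≤ suc K) (+-comm K 2) (≤-trans k[k-1]+2≤n (s≤s n'≤K)))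
    where
    K = k * (k ∸ 1)
    |S|≤k : length S ≤ k
    |S|≤k = +-cancelʳ-≤ d (length S) k (begin
      length S + d  ≡⟨ |S|+d≡n ⟩
      n             ≤⟨ m≤n+m∸n n k ⟩
      k + (n ∸ k)   ≤⟨ +-monoʳ-≤ k n∸k≤d ⟩
      k + d         ∎)
      where open ≤-Reasoning
    n'≤K : n' ≤ K
    n'≤K = ≤-trans (differences-bound w≢⋄ⁿ) (*-mono-≤ |S|≤k (∸-monoˡ-≤ 1 |S|≤k))

no-high-diamondicity : (m n k : ℕ) → 1 ≤ m → 1 ≤ n → k * (k ∸ 1) + 2 ≤ n →
  (w : PartialWord m) (d : ℕ) → Pseudocyclic n w → Universal m n w → w ≢ diamonds n →
  HasDiamondicity n w d → n ∸ k ≤ d → ⊥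
no-high-diamondicity (suc m) (suc n') k _ _ hyp w d pseudocyclic univ w≢⋄ⁿ diamondicity =
  PseudocyclicUniversal.no-diamondicity-above pseudocyclic univ diamondicity k hyp w≢⋄ⁿ

diamondicity-bound : (m n : ℕ) → 1 ≤ m → 2 ≤ n →
  (w : PartialWord m) (d : ℕ) → Pseudocyclic n w → Universal m n w → w ≢ diamonds n →
  HasDiamondicity n w d → (d < n) × (4 * n < (2 * (n ∸ d) ∸ 1) ^ 2 + 7)
diamondicity-bound m n 1≤m 2≤n w d pseudocyclic univ w≢⋄ⁿ diamondicity = d<n , square-bound′
  where
  excluded : ∀ k → k * (k ∸ 1) + 2 ≤ n → n ∸ k ≤ d → ⊥
  excluded k hyp = no-high-diamondicity m n k 1≤m (≤-trans (s≤s z≤n) 2≤n) hyp w d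
                     pseudocyclic univ w≢⋄ⁿ diamondicity
  d<n : d < n
  d<n = ≰⇒> (excluded 0 2≤n)
  n≤ : ∀ s → n ∸ d ≡ suc s → n ≤ suc s * s + 1
  n≤ s eq = ≤-pred (subst (suc n ≤_) (+-suc (suc s * s) 1) (≰⇒> λ hyp →
    excluded (suc s) hyp (≤-reflexive (trans (cong (n ∸_) (sym eq)) (m∸[m∸n]≡n (<⇒≤ d<n))))))
  square-bound′ : 4 * n < (2 * (n ∸ d) ∸ 1) ^ 2 + 7
  square-bound′ with n ∸ d in eq
  ... | zero  = contradiction (m∸n≡0⇒m≤n eq) (<⇒≱ d<n)
  ... | suc s = square-bound s n (n≤ s eq)

proposition4p7 :
    ((m n k : ℕ) → 1 ≤ m → 1 ≤ n → k * (k ∸ 1) + 2 ≤ n →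
      (w : PartialWord m) (d : ℕ) →
      Pseudocyclic n w → Universal m n w → w ≢ diamonds n →
      HasDiamondicity n w d → n ∸ k ≤ d → ⊥)
    ×
    ((m n : ℕ) → 1 ≤ m → 2 ≤ n →
      (w : PartialWord m) (d : ℕ) →
      Pseudocyclic n w → Universal m n w → w ≢ diamonds n →
      HasDiamondicity n w d →
      (d < n) × (4 * n < (2 * (n ∸ d) ∸ 1) ^ 2 + 7))
proposition4p7 = no-high-diamondicity , diamondicity-bound
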